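{- Let $H$ be a nonempty graph (i.e., a finite, simple, undirected graph with at least one edge), let $n\in\mathbb{N}$, and let $\mathcal{G}$ be an $H$-intersecting family of graphs on the common vertex set $[n]=\{1,\ldots,n\}$. Then \[ |\mathcal{G}| \leq 2^{\binom{n}{2}-(\chi(H)-1)}, \] where $\chi(H)$ is the chromatic number of $H$.
   Context: All graphs are finite, simple and undirected. A family $\mathcal{G}$ of (distinct) graphs on a common vertex set is called $H$-intersecting if for every two graphs $G_1,G_2\in\mathcal{G}$, the graph $G_1\cap G_2$ (on the common vertex set, with edge set $E(G_1)\cap E(G_2)$) contains a subgraph isomorphic to $H$. -}

module Defs where

open import Data.Nat using (ℕ; _≤_)
open import Data.Fin using (Fin)
open import Data.Bool using (Bool; true; false; _∧_)
open import Data.Product using (Σ; ∃; ∃-syntax; _×_)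
open import Relation.Binary.PropositionalEquality using (_≡_; _≢_)
open import Function.Definitions using (Injective)

record Graph (n : ℕ) : Set where
  field
    adj   : Fin n → Fin n → Bool
    sym   : ∀ u v → adj u v ≡ adj v u
    irrefl : ∀ v → adj v v ≡ false
open Graph public

NonEmpty : ∀ {k} → Graph k → Set
NonEmpty H = ∃[ u ] ∃[ v ] adj H u v ≡ true

_∩_ : ∀ {n} → Graph n → Graph n → Graph n
adj (G₁ ∩ G₂) u v = adj G₁ u v ∧ adj G₂ u v
sym (G₁ ∩ G₂) u v rewrite sym G₁ u v | sym G₂ u v = Relation.Binary.PropositionalEquality.refl
  where import Relation.Binary.PropositionalEquality
irrefl (G₁ ∩ G₂) v rewrite irrefl G₁ v = Relation.Binary.PropositionalEquality.refl
  where import Relation.Binary.PropositionalEquality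

ContainsCopy : ∀ {k n} → Graph n → Graph k → Set
ContainsCopy {k} {n} G H =
  Σ (Fin k → Fin n) λ f →
    Injective _≡_ _≡_ f × (∀ u v → adj H u v ≡ true → adj G (f u) (f v) ≡ true)

Distinct : ∀ {n} → Graph n → Graph n → Set
Distinct G₁ G₂ = ∃[ u ] ∃[ v ] adj G₁ u v ≢ adj G₂ u v

-- A family of m graphs on [n], indexed by Fin m, is a family of distinct graphs
-- (so its cardinality is m) when different indices give distinct graphs.
PairwiseDistinct : ∀ {m n} → (Fin m → Graph n) → Set
PairwiseDistinct {m} 𝒢 = ∀ (i j : Fin m) → i ≢ j → Distinct (𝒢 i) (𝒢 j)

HIntersecting : ∀ {m n k} → Graph k → (Fin m → Graph n) → Set
HIntersecting {m} H 𝒢 = ∀ (i j : Fin m) → i ≢ j → ContainsCopy (𝒢 i ∩ 𝒢 j) H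

Colorable : ∀ {k} → Graph k → ℕ → Set
Colorable {k} H c =
  Σ (Fin k → Fin c) λ col → ∀ u v → adj H u v ≡ true → col u ≢ col v

IsChromaticNumber : ∀ {k} → Graph k → ℕ → Set
IsChromaticNumber H c = Colorable H c × (∀ c′ → Colorable H c′ → c ≤ c′)

-- Write s = χ(H) − 1 and, for a colouring c of [n] with s colours, let E_c be the set of
-- c-monochromatic pairs. As H is not s-colourable, every copy of H in G₁ ∩ G₂ has an edge in E_c,
-- so the traces of 𝒢 on E_c form an intersecting family: at most 2 ^ (|E_c| − 1) of them. Every
-- pair lies in E_c for exactly s ^ (n − 1) of the s ^ n colourings, so Shearer's lemma gives
-- |𝒢| ^ (s ^ (n − 1)) ≤ ∏_c 2 ^ (|E_c| − 1) = 2 ^ (s ^ (n − 1) · (n C 2) − s ^ n), that is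
-- |𝒢| ≤ 2 ^ ((n C 2) − s). Shearer's lemma is proved by induction on the ground set; its inductive
-- step is the superadditivity (∏ aᵢ)^(1/k) + (∏ bᵢ)^(1/k) ≤ (∏ (aᵢ + bᵢ))^(1/k) of the geometric
-- mean, which in turn follows from AM-GM.

module Submission where

import Algebra.Properties.CommutativeSemigroup as CommutativeSemigroupProperties
open import Data.Bool using (Bool; true; false; not; T; _∧_)
import Data.Bool as Bool
open import Data.Bool.Properties using (not-injective)
open import Data.Empty using (⊥)
open import Data.Fin using (Fin; zero; suc)
import Data.Fin as Fin
import Data.Fin.Properties as Fin
open import Data.List using (List; []; _∷_; _++_; length; map; zipWith; filterᵇ; tabulate; allFin; cartesianProductWith)
open import Data.List.Properties
  using (length-tabulate; length-map; length-zipWith; length-++; zipWith-comm; map-cong-local; filter-++; map-tabulate)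
open import Data.List.Membership.Propositional using (_∈_; find; lose)
open import Data.List.Membership.Propositional.Properties
  using (∈-∃++; ∈-filter⁻; ∈-filter⁺; ∈-++⁺ˡ; ∈-++⁺ʳ; ∈-++⁻; ∈-map⁺; ∈-map⁻; ∈-tabulate⁺; ∈-tabulate⁻)
open import Data.List.Relation.Binary.Permutation.Propositional using (_↭_; prep; ↭-trans)
open import Data.List.Relation.Binary.Permutation.Propositional.Properties using (shift; ↭-length)
open import Data.List.Relation.Binary.Subset.Propositional using (_⊆_)
open import Data.List.Relation.Binary.Subset.Propositional.Properties using (filter-⊆; filter⁺′)
open import Data.List.Relation.Unary.All using (All; []; _∷_; all?)
import Data.List.Relation.Unary.All as All
open import Data.List.Relation.Unary.All.Properties using (¬All⇒Any¬; all-filter)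
open import Data.List.Relation.Unary.AllPairs using (AllPairs; []; _∷_)
import Data.List.Relation.Unary.AllPairs.Properties as AllPairs
open import Data.List.Relation.Unary.Any using (Any; here; there; any?)
import Data.List.Relation.Unary.Any as Any
open import Data.Nat
open import Data.Nat.Combinatorics using (_C_; nC1≡n; nCk+nC[k+1]≡[n+1]C[k+1])
open import Data.Nat.ListAction using (sum; product)
open import Data.Nat.ListAction.Properties using (sum-↭; product-↭)
open import Data.Nat.Properties
open import Data.Nat.Tactic.RingSolver using (solve-∀)
open import Data.Product using (∃; ∃₂; _×_; _,_; proj₁; proj₂; swap)
import Data.Product as Product
open import Data.Sum using (inj₁; inj₂)
import Data.Vec.Functional as Vector
open import Defs hiding (sym)
open import Function using (_∘_; id)
open import Relation.Binary.Definitions using (tri<; tri≈; tri>)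
open import Relation.Binary.PropositionalEquality
  using (_≡_; _≢_; refl; sym; trans; cong; cong₂; subst; subst₂; module ≡-Reasoning)
open import Relation.Nullary using (¬_; yes; no; contradiction)
open import Relation.Nullary.Decidable using (T?; does)

open CommutativeSemigroupProperties +-commutativeSemigroup using () renaming (x∙yz≈y∙xz to +-left-comm)
open CommutativeSemigroupProperties *-commutativeSemigroup using () renaming (x∙yz≈y∙xz to *-left-comm)

^-distribʳ-* : ∀ m n o → (m * n) ^ o ≡ m ^ o * n ^ o
^-distribʳ-* m n zero    = refl
^-distribʳ-* m n (suc o) =
  trans (cong (m * n *_) (^-distribʳ-* m n o)) ([m*n]*[o*p]≡[m*o]*[n*p] m n (m ^ o) (n ^ o))

^-cancelʳ-≤ : ∀ k .{{_ : NonZero k}} {m n} → m ^ k ≤ n ^ k → m ≤ n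
^-cancelʳ-≤ k {m} {n} mᵏ≤nᵏ with m ≤? n
... | yes m≤n = m≤n
... | no  m≰n = contradiction mᵏ≤nᵏ (<⇒≱ (^-monoˡ-< k (≰⇒> m≰n)))

m≤^∸ : ∀ {b m N} s → 1 < b → b ^ s * m ≤ b ^ N → m ≤ b ^ (N ∸ s)
m≤^∸ {b} {m} {N} s 1<b bˢm≤bᴺ with s ≤? N
... | yes s≤N = *-cancelˡ-≤ (b ^ s) {{m^n≢0 b s}} (begin
  b ^ s * m               ≤⟨ bˢm≤bᴺ ⟩
  b ^ N                   ≡⟨ cong (b ^_) (m+[n∸m]≡n s≤N) ⟨
  b ^ (s + (N ∸ s))       ≡⟨ ^-distribˡ-+-* b s (N ∸ s) ⟩
  b ^ s * b ^ (N ∸ s)     ∎)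
  where
  open ≤-Reasoning
  instance _ = >-nonZero (<-trans z<s 1<b)
... | no  s≰N with m
...   | zero   = z≤n
...   | suc m′ = contradiction (≤-trans (m≤m*n (b ^ s) (suc m′)) bˢm≤bᴺ) (<⇒≱ (^-monoʳ-< b 1<b (≰⇒> s≰N)))

-- AM-GM

product≤^length : ∀ {w zs} → All (_≤ w) zs → product zs ≤ w ^ length zs
product≤^length []           = ≤-refl
product≤^length (z≤w ∷ zs≤w) = *-mono-≤ z≤w (product≤^length zs≤w)

length*≤sum : ∀ {w zs} → All (w ≤_) zs → length zs * w ≤ sum zs
length*≤sum []           = ≤-refl
length*≤sum (w≤z ∷ w≤zs) = +-mono-≤ w≤z (length*≤sum w≤zs)

Any⇒∃↭ : ∀ {P : ℕ → Set} {zs} → Any P zs → ∃₂ λ z rest → P z × zs ↭ z ∷ rest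
Any⇒∃↭ any with z , z∈zs , pz ← find any with ys , ys′ , refl ← ∈-∃++ z∈zs =
  z , ys ++ ys′ , pz , shift z ys ys′

some-above : ∀ {w zs} → ¬ All (_≤ w) zs → Any (w <_) zs
some-above {w} {zs} ¬zs≤w = Any.map ≰⇒> (¬All⇒Any¬ (_≤? w) zs ¬zs≤w)

some-below : ∀ {w zs} → sum zs < length zs * w → Any (_< w) zs
some-below {w} {zs} small =
  Any.map ≰⇒> (¬All⇒Any¬ (w ≤?_) zs (λ w≤zs → <⇒≱ small (length*≤sum w≤zs)))

rest-below-average : ∀ {w z zs rest} → w < z → zs ↭ z ∷ rest →
               sum zs ≤ length zs * w → sum rest < length rest * w
rest-below-average {w} {z} {zs} {rest} w<z zs↭ sum≤ = +-cancelˡ-< w _ _ (begin-strict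
  w + sum rest             <⟨ +-monoˡ-< (sum rest) w<z ⟩
  z + sum rest             ≡⟨ sum-↭ zs↭ ⟨
  sum zs                   ≤⟨ sum≤ ⟩
  length zs * w            ≡⟨ cong (_* w) (↭-length zs↭) ⟩
  w + length rest * w      ∎)
  where open ≤-Reasoning

off-centre-pair : ∀ {w zs} → ¬ All (_≤ w) zs → sum zs ≤ length zs * w →
                  ∃₂ λ z z′ → ∃ λ rest → w < z × z′ < w × zs ↭ z ∷ z′ ∷ rest
off-centre-pair ¬zs≤w sum≤ with z , rest , w<z , zs↭ ← Any⇒∃↭ (some-above ¬zs≤w)
  with z′ , rest′ , z′<w , rest↭ ← Any⇒∃↭ (some-below (rest-below-average w<z zs↭ sum≤)) =
  z , z′ , rest′ , w<z , z′<w , ↭-trans zs↭ (prep z rest↭)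

smoothing : ∀ {w z z′} → w ≤ z → z′ ≤ w → z * z′ ≤ w * (z + z′ ∸ w)
smoothing {w} {z} {z′} w≤z z′≤w with d , refl ← m≤n⇒∃[o]m+o≡n w≤z = begin
  (w + d) * z′            ≡⟨ *-distribʳ-+ z′ w d ⟩
  w * z′ + d * z′         ≤⟨ +-monoʳ-≤ (w * z′) (*-monoʳ-≤ d z′≤w) ⟩
  w * z′ + d * w          ≡⟨ cong (w * z′ +_) (*-comm d w) ⟩
  w * z′ + w * d          ≡⟨ *-distribˡ-+ w z′ d ⟨
  w * (z′ + d)            ≡⟨ cong (w *_) (+-comm z′ d) ⟩
  w * (d + z′)            ≡⟨ cong (w *_) (m+n∸m≡n w (d + z′)) ⟨
  w * (w + (d + z′) ∸ w)  ≡⟨ cong (λ t → w * (t ∸ w)) (+-assoc w d z′) ⟨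
  w * (w + d + z′ ∸ w)    ∎
  where open ≤-Reasoning

am-gm : ∀ n {w zs} → length zs ≡ n → sum zs ≤ n * w → product zs ≤ w ^ n
am-gm zero    {zs = []} _ _ = ≤-refl
am-gm (suc n) {w} {zs} len sum≤ with all? (_≤? w) zs
... | yes zs≤w = subst (λ k → product zs ≤ w ^ k) len (product≤^length zs≤w)
... | no ¬zs≤w
  with z , z′ , rest , w<z , z′<w , zs↭
         ← off-centre-pair ¬zs≤w (subst (λ k → sum zs ≤ k * w) (sym len) sum≤) = begin
  product zs                         ≡⟨ product-↭ zs↭ ⟩
  z * (z′ * product rest)            ≡⟨ *-assoc z z′ _ ⟨
  z * z′ * product rest              ≤⟨ *-monoˡ-≤ _ (smoothing (<⇒≤ w<z) (<⇒≤ z′<w)) ⟩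
  w * (z + z′ ∸ w) * product rest    ≡⟨ *-assoc w _ _ ⟩
  w * product (z + z′ ∸ w ∷ rest)    ≤⟨ *-monoʳ-≤ w (am-gm n {zs = z + z′ ∸ w ∷ rest} length-smoothed sum-smoothed) ⟩
  w ^ suc n                          ∎
  where
  open ≤-Reasoning
  length-smoothed : suc (length rest) ≡ n
  length-smoothed = suc-injective (trans (sym (↭-length zs↭)) len)
  sum-smoothed : z + z′ ∸ w + sum rest ≤ n * w
  sum-smoothed = +-cancelˡ-≤ w _ _ (begin
    w + (z + z′ ∸ w + sum rest)      ≡⟨ +-assoc w _ _ ⟨
    w + (z + z′ ∸ w) + sum rest      ≡⟨ cong (_+ sum rest) (m+[n∸m]≡n (≤-trans (<⇒≤ w<z) (m≤m+n z z′))) ⟩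
    z + z′ + sum rest                ≡⟨ +-assoc z z′ _ ⟩
    z + (z′ + sum rest)              ≡⟨ sum-↭ zs↭ ⟨
    sum zs                           ≤⟨ sum≤ ⟩
    w + n * w                        ∎)

T-agree : ∀ {a b} → T a → T b → a ≡ b
T-agree {true} {true} _ _ = refl

∧-≡-true : ∀ {a b} → a ∧ b ≡ true → a ≡ true × b ≡ true
∧-≡-true {true} {true} _ = refl , refl

module _ {B : Set} where

  count : (B → Bool) → List B → ℕ
  count p ys = length (filterᵇ p ys)

  count-++ : ∀ p xs ys → count p (xs ++ ys) ≡ count p xs + count p ys
  count-++ p xs ys = trans (cong length (filter-++ (T? ∘ p) xs ys)) (length-++ (filterᵇ p xs))

  count-const-false : ∀ ys → count (λ _ → false) ys ≡ 0
  count-const-false []       = refl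
  count-const-false (_ ∷ ys) = count-const-false ys

  length≡count-not+count : ∀ p ys → length ys ≡ count (not ∘ p) ys + count p ys
  length≡count-not+count p []       = refl
  length≡count-not+count p (y ∷ ys) with p y
  ... | true  = trans (cong suc (length≡count-not+count p ys)) (sym (+-suc _ _))
  ... | false = cong suc (length≡count-not+count p ys)

  product-map-split : ∀ p (f : B → ℕ) ys →
    product (map f ys) ≡ product (map f (filterᵇ p ys)) * product (map f (filterᵇ (not ∘ p) ys))
  product-map-split p f []       = refl
  product-map-split p f (y ∷ ys) with p y
  ... | true  = trans (cong (f y *_) (product-map-split p f ys)) (sym (*-assoc (f y) _ _))
  ... | false = trans (cong (f y *_) (product-map-split p f ys)) (*-left-comm (f y) (product (map f (filterᵇ p ys))) _)

  product-map-mono : ∀ {f g : B → ℕ} → ∀ {ys} → All (λ y → f y ≤ g y) ys → product (map f ys) ≤ product (map g ys)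
  product-map-mono []         = ≤-refl
  product-map-mono (fy≤gy ∷ h) = *-mono-≤ fy≤gy (product-map-mono h)

  zipWith-map-map : ∀ (f : ℕ → ℕ → ℕ) (a b : B → ℕ) ys → zipWith f (map a ys) (map b ys) ≡ map (λ y → f (a y) (b y)) ys
  zipWith-map-map f a b []       = refl
  zipWith-map-map f a b (y ∷ ys) = cong (f (a y) (b y) ∷_) (zipWith-map-map f a b ys)

  product-map-one : ∀ ys → product (map (λ (_ : B) → 1) ys) ≡ 1
  product-map-one []       = refl
  product-map-one (_ ∷ ys) = trans (+-identityʳ _) (product-map-one ys)

  sum-map-const : ∀ {f : B → ℕ} {k} ys → All (λ y → f y ≡ k) ys → sum (map f ys) ≡ k * length ys
  sum-map-const {k = k} []       []           = sym (*-zeroʳ k)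
  sum-map-const {k = k} (_ ∷ ys) (fy≡k ∷ fys) = trans (cong₂ _+_ fy≡k (sum-map-const ys fys)) (sym (*-suc k _))

  ^length*product≤^sum : ∀ {m} {g h : B → ℕ} {ys} → All (λ y → m * g y ≤ m ^ h y) ys →
    m ^ length ys * product (map g ys) ≤ m ^ sum (map h ys)
  ^length*product≤^sum []                                  = ≤-refl
  ^length*product≤^sum {m} {g} {h} {y ∷ ys} (mgy≤ ∷ mgys≤) = begin
    m * m ^ length ys * (g y * product (map g ys))      ≡⟨ [m*n]*[o*p]≡[m*o]*[n*p] m (m ^ length ys) (g y) _ ⟩
    m * g y * (m ^ length ys * product (map g ys))      ≤⟨ *-mono-≤ mgy≤ (^length*product≤^sum mgys≤) ⟩
    m ^ h y * m ^ sum (map h ys)                        ≡⟨ ^-distribˡ-+-* m (h y) _ ⟨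
    m ^ (h y + sum (map h ys))                          ∎
    where open ≤-Reasoning

  AllPairs-weaken : ∀ {R S : B → B → Set} {P : B → Set} {ys} → (∀ {y z} → P y → P z → R y z → S y z) →
    All P ys → AllPairs R ys → AllPairs S ys
  AllPairs-weaken weaken []         []           = []
  AllPairs-weaken weaken (py ∷ pys) (Ry ∷ Rys) =
    All.zipWith (λ (pz , Ryz) → weaken py pz Ryz) (pys , Ry) ∷ AllPairs-weaken weaken pys Rys

module _ {B C : Set} (r : B → C → Bool) where

  sum-map-count-∷ : ∀ ys z zs →
    sum (map (λ y → count (r y) (z ∷ zs)) ys) ≡ count (λ y → r y z) ys + sum (map (λ y → count (r y) zs) ys)
  sum-map-count-∷ []       z zs = refl
  sum-map-count-∷ (y ∷ ys) z zs with r y z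
  ... | true  = cong suc (trans (cong (count (r y) zs +_) (sum-map-count-∷ ys z zs))
                                (+-left-comm (count (r y) zs) (count (λ y → r y z) ys) _))
  ... | false = trans (cong (count (r y) zs +_) (sum-map-count-∷ ys z zs))
                      (+-left-comm (count (r y) zs) (count (λ y → r y z) ys) _)

  sum-map-count-swap : ∀ ys zs →
    sum (map (λ y → count (r y) zs) ys) ≡ sum (map (λ z → count (λ y → r y z) ys) zs)
  sum-map-count-swap ys []       = sum-map-const ys (All.tabulate λ _ → refl)
  sum-map-count-swap ys (z ∷ zs) =
    trans (sum-map-count-∷ ys z zs) (cong (count (λ y → r y z) ys +_) (sum-map-count-swap ys zs))

module _ {B C : Set} where

  count-map : ∀ (p : C → Bool) (g : B → C) ys → count p (map g ys) ≡ count (p ∘ g) ys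
  count-map p g []       = refl
  count-map p g (y ∷ ys) with p (g y)
  ... | true  = cong suc (count-map p g ys)
  ... | false = count-map p g ys

module _ {B C D : Set} (f : B → C → D) where

  length-cartesianProductWith : ∀ xs ys → length (cartesianProductWith f xs ys) ≡ length xs * length ys
  length-cartesianProductWith []       ys = refl
  length-cartesianProductWith (x ∷ xs) ys =
    trans (length-++ (map (f x) ys)) (cong₂ _+_ (length-map (f x) ys) (length-cartesianProductWith xs ys))

  count-cartesianProductWith : ∀ p xs ys → count p (cartesianProductWith f xs ys) ≡ sum (map (λ x → count (p ∘ f x) ys) xs)
  count-cartesianProductWith p []       ys = refl
  count-cartesianProductWith p (x ∷ xs) ys =
    trans (count-++ p (map (f x) ys) _) (cong₂ _+_ (count-map p (f x) ys) (count-cartesianProductWith p xs ys))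

-- Superadditivity of the geometric mean

length-zipWith-≡ : ∀ (f : ℕ → ℕ → ℕ) xs ys → length xs ≡ length ys → length (zipWith f xs ys) ≡ length xs
length-zipWith-≡ f xs ys eq = trans (length-zipWith f xs ys) (trans (cong (length xs ⊓_) (sym eq)) (⊓-idem _))

product-map-* : ∀ c ys → product (map (c *_) ys) ≡ c ^ length ys * product ys
product-map-* c []       = refl
product-map-* c (y ∷ ys) =
  trans (cong (c * y *_) (product-map-* c ys)) ([m*n]*[o*p]≡[m*o]*[n*p] c y (c ^ length ys) (product ys))

product-zipWith-* : ∀ xs ys → length xs ≡ length ys → product (zipWith _*_ xs ys) ≡ product xs * product ys
product-zipWith-* []       []       _  = refl
product-zipWith-* (x ∷ xs) (y ∷ ys) eq =
  trans (cong (x * y *_) (product-zipWith-* xs ys (suc-injective eq)))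
        ([m*n]*[o*p]≡[m*o]*[n*p] x y (product xs) (product ys))

sum-zipWith-map-* : ∀ c xs ys → sum (zipWith _*_ xs (map (c *_) ys)) ≡ c * sum (zipWith _*_ xs ys)
sum-zipWith-map-* c []       ys       = sym (*-zeroʳ c)
sum-zipWith-map-* c (x ∷ xs) []       = sym (*-zeroʳ c)
sum-zipWith-map-* c (x ∷ xs) (y ∷ ys) =
  trans (cong (x * (c * y) +_) (sum-zipWith-map-* c xs ys)) (lemma x c y (sum (zipWith _*_ xs ys)))
  where
  lemma : ∀ a b d e → a * (b * d) + b * e ≡ b * (a * d + e)
  lemma = solve-∀

sum-zipWith-*-+ : ∀ as bs ws → length as ≡ length bs →
  sum (zipWith _*_ as ws) + sum (zipWith _*_ bs ws) ≡ sum (zipWith _*_ (zipWith _+_ as bs) ws)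
sum-zipWith-*-+ []       []       ws       _  = refl
sum-zipWith-*-+ (a ∷ as) (b ∷ bs) []       _  = refl
sum-zipWith-*-+ (a ∷ as) (b ∷ bs) (w ∷ ws) eq =
  trans (lemma a b w (sum (zipWith _*_ as ws)) (sum (zipWith _*_ bs ws)))
        (cong ((a + b) * w +_) (sum-zipWith-*-+ as bs ws (suc-injective eq)))
  where
  lemma : ∀ a b w x y → a * w + x + (b * w + y) ≡ (a + b) * w + (x + y)
  lemma = solve-∀

product-zipWith-+ˡ : ∀ as bs → length as ≡ length bs → product as ≤ product (zipWith _+_ as bs)
product-zipWith-+ˡ []       []       _  = ≤-refl
product-zipWith-+ˡ (a ∷ as) (b ∷ bs) eq = *-mono-≤ (m≤m+n a b) (product-zipWith-+ˡ as bs (suc-injective eq))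

-- The i-th entry of leaveOneOut us is the product of all entries of us but the i-th.
leaveOneOut : List ℕ → List ℕ
leaveOneOut []       = []
leaveOneOut (u ∷ us) = product us ∷ map (u *_) (leaveOneOut us)

length-leaveOneOut : ∀ us → length (leaveOneOut us) ≡ length us
length-leaveOneOut []       = refl
length-leaveOneOut (u ∷ us) = cong suc (trans (length-map (u *_) (leaveOneOut us)) (length-leaveOneOut us))

sum-zipWith-leaveOneOut : ∀ us → sum (zipWith _*_ us (leaveOneOut us)) ≡ length us * product us
sum-zipWith-leaveOneOut []       = refl
sum-zipWith-leaveOneOut (u ∷ us) = begin
  u * product us + sum (zipWith _*_ us (map (u *_) (leaveOneOut us)))
    ≡⟨ cong (u * product us +_) (sum-zipWith-map-* u us (leaveOneOut us)) ⟩
  u * product us + u * sum (zipWith _*_ us (leaveOneOut us))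
    ≡⟨ cong (λ t → u * product us + u * t) (sum-zipWith-leaveOneOut us) ⟩
  u * product us + u * (length us * product us)
    ≡⟨ lemma u (product us) (length us) ⟩
  suc (length us) * (u * product us) ∎
  where
  open ≡-Reasoning
  lemma : ∀ a b n → a * b + a * (n * b) ≡ (1 + n) * (a * b)
  lemma = solve-∀

product-leaveOneOut : ∀ us → product (leaveOneOut us) * product us ≡ product us ^ length us
product-leaveOneOut []       = refl
product-leaveOneOut (u ∷ us) = begin
  product us * product (map (u *_) (leaveOneOut us)) * (u * product us)
    ≡⟨ cong (λ t → product us * t * (u * product us)) (product-map-* u (leaveOneOut us)) ⟩
  product us * (u ^ length (leaveOneOut us) * product (leaveOneOut us)) * (u * product us)
    ≡⟨ cong (λ t → product us * (u ^ t * product (leaveOneOut us)) * (u * product us)) (length-leaveOneOut us) ⟩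
  product us * (u ^ length us * product (leaveOneOut us)) * (u * product us)
    ≡⟨ lemma (product us) (u ^ length us) (product (leaveOneOut us)) u ⟩
  u * u ^ length us * (product us * (product (leaveOneOut us) * product us))
    ≡⟨ cong (λ t → u * u ^ length us * (product us * t)) (product-leaveOneOut us) ⟩
  u ^ suc (length us) * product us ^ suc (length us)
    ≡⟨ ^-distribʳ-* u (product us) (suc (length us)) ⟨
  (u * product us) ^ suc (length us) ∎
  where
  open ≡-Reasoning
  lemma : ∀ a b c d → a * (b * c) * (d * a) ≡ d * b * (a * (c * a))
  lemma = solve-∀

product-weighted : ∀ g xs us → length xs ≡ length us →
  product (zipWith _*_ xs (map (g *_) (leaveOneOut us))) * product us
    ≡ product xs * g ^ length us * product us ^ length us
product-weighted g xs us eq = begin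
  product (zipWith _*_ xs ws) * Π
    ≡⟨ cong (_* Π) (product-zipWith-* xs ws (trans eq (sym length-ws))) ⟩
  product xs * product ws * Π
    ≡⟨ cong (λ t → product xs * t * Π) (product-map-* g (leaveOneOut us)) ⟩
  product xs * (g ^ length (leaveOneOut us) * product (leaveOneOut us)) * Π
    ≡⟨ cong (λ t → product xs * (g ^ t * product (leaveOneOut us)) * Π) (length-leaveOneOut us) ⟩
  product xs * (g ^ length us * product (leaveOneOut us)) * Π
    ≡⟨ lemma (product xs) (g ^ length us) (product (leaveOneOut us)) Π ⟩
  product xs * g ^ length us * (product (leaveOneOut us) * Π)
    ≡⟨ cong (product xs * g ^ length us *_) (product-leaveOneOut us) ⟩
  product xs * g ^ length us * Π ^ length us ∎
  where
  open ≡-Reasoning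
  Π = product us
  ws = map (g *_) (leaveOneOut us)
  length-ws : length ws ≡ length us
  length-ws = trans (length-map (g *_) (leaveOneOut us)) (length-leaveOneOut us)
  lemma : ∀ a b c d → a * (b * c) * d ≡ a * b * (c * d)
  lemma = solve-∀

weighted-sum-large : ∀ {t g} xs us → length xs ≡ length us → 0 < t → 0 < product us →
  product us < g ^ length us → t ^ length us ≤ product xs →
  length us * (t * product us) < sum (zipWith _*_ xs (map (g *_) (leaveOneOut us)))
weighted-sum-large {t} {g} xs us eq t>0 Π>0 Π<gᵏ tᵏ≤xs =
  ≰⇒> λ small → <⇒≱ product-large (am-gm k {zs = zs} length-zs small)
  where
  k = length us
  Π = product us
  zs = zipWith _*_ xs (map (g *_) (leaveOneOut us))
  length-ws : length (map (g *_) (leaveOneOut us)) ≡ k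
  length-ws = trans (length-map (g *_) (leaveOneOut us)) (length-leaveOneOut us)
  length-zs : length zs ≡ k
  length-zs = trans (length-zipWith-≡ _*_ xs _ (trans eq (sym length-ws))) eq
  instance
    _ = >-nonZero Π>0
    _ = >-nonZero (m^n>0 t {{>-nonZero t>0}} k)
    _ = >-nonZero (m^n>0 Π k)
  product-large : (t * Π) ^ k < product zs
  product-large = *-cancelʳ-< Π _ _ (begin-strict
    (t * Π) ^ k * Π              ≡⟨ cong (_* Π) (^-distribʳ-* t Π k) ⟩
    t ^ k * Π ^ k * Π            ≡⟨ lemma (t ^ k) (Π ^ k) Π ⟩
    t ^ k * Π * Π ^ k            <⟨ *-monoˡ-< (Π ^ k) (*-monoʳ-< (t ^ k) Π<gᵏ) ⟩
    t ^ k * g ^ k * Π ^ k        ≤⟨ *-monoˡ-≤ (Π ^ k) (*-monoˡ-≤ (g ^ k) tᵏ≤xs) ⟩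
    product xs * g ^ k * Π ^ k   ≡⟨ product-weighted g xs us eq ⟨
    product zs * Π               ∎)
    where
    open ≤-Reasoning
    lemma : ∀ a b c → a * b * c ≡ a * c * b
    lemma = solve-∀

-- If ∏ (aᵢ + bᵢ) < (p + q) ^ k, weight coordinate i by (p + q) · ∏_{j≠i} (aⱼ + bⱼ): the weighted
-- sums of the aᵢ and of the bᵢ add up to k · (p + q) · ∏ (aᵢ + bᵢ), yet by AM-GM they exceed
-- k · p · ∏ (aᵢ + bᵢ) and k · q · ∏ (aᵢ + bᵢ) respectively.
geometric-mean-superadditive : ∀ {p q} as bs → length as ≡ length bs →
  p ^ length as ≤ product as → q ^ length as ≤ product bs →
  (p + q) ^ length as ≤ product (zipWith _+_ as bs)
geometric-mean-superadditive {p} {zero} as bs eq pᵏ≤as _ =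
  subst (λ x → x ^ length as ≤ _) (sym (+-identityʳ p)) (≤-trans pᵏ≤as (product-zipWith-+ˡ as bs eq))
geometric-mean-superadditive {zero} {q} as bs eq _ qᵏ≤bs = begin
  q ^ length as                 ≤⟨ qᵏ≤bs ⟩
  product bs                    ≤⟨ product-zipWith-+ˡ bs as (sym eq) ⟩
  product (zipWith _+_ bs as)   ≡⟨ cong product (zipWith-comm _+_ +-comm bs as) ⟩
  product (zipWith _+_ as bs)   ∎
  where open ≤-Reasoning
geometric-mean-superadditive {p@(suc _)} {q@(suc _)} as bs eq pᵏ≤as qᵏ≤bs
  with (p + q) ^ length as ≤? product (zipWith _+_ as bs)
... | yes gᵏ≤Π = gᵏ≤Π
... | no gᵏ≰Π = contradiction weighted-sums (<-irrefl refl)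
  where
  us = zipWith _+_ as bs
  Π = product us
  k = length us
  ws = map ((p + q) *_) (leaveOneOut us)
  length-us : length us ≡ length as
  length-us = length-zipWith-≡ _+_ as bs eq
  Π>0 : 0 < Π
  Π>0 = <-≤-trans (m^n>0 p (length as)) (≤-trans pᵏ≤as (product-zipWith-+ˡ as bs eq))
  Π<gᵏ : Π < (p + q) ^ k
  Π<gᵏ = subst (λ i → Π < (p + q) ^ i) (sym length-us) (≰⇒> gᵏ≰Π)
  large : ∀ t xs → length xs ≡ length as → 0 < t → t ^ length as ≤ product xs →
          k * (t * Π) < sum (zipWith _*_ xs ws)
  large t xs eq′ t>0 tᵏ≤xs =
    weighted-sum-large xs us (trans eq′ (sym length-us)) t>0 Π>0 Π<gᵏ
      (subst (λ i → t ^ i ≤ product xs) (sym length-us) tᵏ≤xs)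
  weighted-sums : k * (p * Π) + k * (q * Π) < k * (p * Π) + k * (q * Π)
  weighted-sums = begin-strict
    k * (p * Π) + k * (q * Π)                               <⟨ +-mono-< (large p as refl z<s pᵏ≤as)
                                                                        (large q bs (sym eq) z<s qᵏ≤bs) ⟩
    sum (zipWith _*_ as ws) + sum (zipWith _*_ bs ws)       ≡⟨ sum-zipWith-*-+ as bs ws eq ⟩
    sum (zipWith _*_ us ws)                                 ≡⟨ sum-zipWith-map-* (p + q) us (leaveOneOut us) ⟩
    (p + q) * sum (zipWith _*_ us (leaveOneOut us))         ≡⟨ cong ((p + q) *_) (sum-zipWith-leaveOneOut us) ⟩
    (p + q) * (k * Π)                                       ≡⟨ lemma p q k Π ⟩
    k * (p * Π) + k * (q * Π)                               ∎
    where
    open ≤-Reasoning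
    lemma : ∀ p q k Π → (p + q) * (k * Π) ≡ k * (p * Π) + k * (q * Π)
    lemma = solve-∀

geometric-mean-superadditive-* : ∀ {p q} r as bs → length as ≡ length bs →
  p ^ length as ≤ r * product as → q ^ length as ≤ r * product bs →
  (p + q) ^ length as ≤ r * product (zipWith _+_ as bs)
geometric-mean-superadditive-* r []       []       _  pᵏ≤ _   = pᵏ≤
geometric-mean-superadditive-* {p} {q} r (a ∷ as) (b ∷ bs) eq pᵏ≤ qᵏ≤ = begin
  (p + q) ^ length (a ∷ as)                        ≤⟨ geometric-mean-superadditive {p} {q} (r * a ∷ as) (r * b ∷ bs) eq
                                                         (subst (p ^ length (a ∷ as) ≤_) (sym (*-assoc r a _)) pᵏ≤)
                                                         (subst (q ^ length (a ∷ as) ≤_) (sym (*-assoc r b _)) qᵏ≤) ⟩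
  (r * a + r * b) * product (zipWith _+_ as bs)     ≡⟨ distrib r a b (product (zipWith _+_ as bs)) ⟩
  r * product (zipWith _+_ (a ∷ as) (b ∷ bs))       ∎
  where
  open ≤-Reasoning
  distrib : ∀ r a b c → (r * a + r * b) * c ≡ r * ((a + b) * c)
  distrib = solve-∀

module _ {B : Set} where

  geometric-mean-superadditive-flagged : ∀ {p q k} (flag : B → Bool) (a b c : B → ℕ) ys → count flag ys ≡ k →
    (∀ {y} → T (flag y) → c y ≡ a y + b y) →
    (∀ {y} → T (not (flag y)) → a y ≤ c y × b y ≤ c y) →
    p ^ k ≤ product (map a ys) → q ^ k ≤ product (map b ys) →
    (p + q) ^ k ≤ product (map c ys)
  geometric-mean-superadditive-flagged {p} {q} {k} flag a b c ys count≡k c≡a+b dominated pᵏ≤ qᵏ≤ = begin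
    (p + q) ^ k                                         ≡⟨ cong ((p + q) ^_) (trans (length-map a J) count≡k) ⟨
    (p + q) ^ length (map a J)                          ≤⟨ geometric-mean-superadditive-* r (map a J) (map b J)
                                                             (trans (length-map a J) (sym (length-map b J)))
                                                             (restrict a proj₁ pᵏ≤) (restrict b proj₂ qᵏ≤) ⟩
    r * product (zipWith _+_ (map a J) (map b J))       ≡⟨ cong (λ zs → r * product zs) (zipWith-map-map _+_ a b J) ⟩
    r * product (map (λ y → a y + b y) J)               ≡⟨ cong (λ zs → r * product zs)
                                                             (map-cong-local (All.map (sym ∘ c≡a+b) (all-filter (T? ∘ flag) ys))) ⟩
    r * product (map c J)                               ≡⟨ *-comm r _ ⟩
    product (map c J) * r                               ≡⟨ product-map-split flag c ys ⟨
    product (map c ys)                                  ∎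
    where
    open ≤-Reasoning
    J = filterᵇ flag ys
    N = filterᵇ (not ∘ flag) ys
    r = product (map c N)
    restrict : ∀ {t} (f : B → ℕ) → (∀ {y} → a y ≤ c y × b y ≤ c y → f y ≤ c y) →
               t ^ k ≤ product (map f ys) → t ^ length (map a J) ≤ r * product (map f J)
    restrict {t} f select tᵏ≤ = begin
      t ^ length (map a J)          ≡⟨ cong (t ^_) (trans (length-map a J) count≡k) ⟩
      t ^ k                         ≤⟨ tᵏ≤ ⟩
      product (map f ys)            ≡⟨ product-map-split flag f ys ⟩
      product (map f J) * product (map f N)
                                    ≤⟨ *-monoʳ-≤ (product (map f J))
                                         (product-map-mono (All.map (select ∘ dominated) (all-filter (T? ∘ not ∘ flag) ys))) ⟩
      product (map f J) * r         ≡⟨ *-comm _ r ⟩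
      r * product (map f J)         ∎

-- Traces and Shearer's lemma

module _ {X : Set} where

  avoiding containing : X → List (X → Bool) → List (X → Bool)
  avoiding   y = filterᵇ (λ f → not (f y))
  containing y = filterᵇ (λ f → f y)

  -- Subsets of X are Boolean predicates; #traces F Y is the number of distinct traces f ∩ Y (f ∈ F).
  #traces : List (X → Bool) → List X → ℕ
  #traces F       (y ∷ Y) = #traces (avoiding y F) Y + #traces (containing y F) Y
  #traces []      []      = 0
  #traces (_ ∷ _) []      = 1

  #traces-mono : ∀ Y {F G} → F ⊆ G → #traces F Y ≤ #traces G Y
  #traces-mono []      {[]}                 _   = z≤n
  #traces-mono []      {_ ∷ _} {[]}    F⊆G = contradiction (F⊆G (here refl)) λ ()
  #traces-mono []      {_ ∷ _} {_ ∷ _} _   = ≤-refl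
  #traces-mono (y ∷ Y) F⊆G = +-mono-≤ (#traces-mono Y (filter⁺′ (T? ∘ λ f → not (f y)) (T? ∘ λ f → not (f y)) id F⊆G))
                                       (#traces-mono Y (filter⁺′ (T? ∘ λ f → f y) (T? ∘ λ f → f y) id F⊆G))

  CrossIntersectingOn : List X → List (X → Bool) → List (X → Bool) → Set
  CrossIntersectingOn Y F G = ∀ {f g} → f ∈ F → g ∈ G → Any (λ y → f y ≡ true × g y ≡ true) Y

  cross-intersecting-tail : ∀ {y Y F G} → (∀ {f g} → f ∈ F → g ∈ G → f y ≡ true → g y ≡ true → ⊥) →
    CrossIntersectingOn (y ∷ Y) F G → CrossIntersectingOn Y F G
  cross-intersecting-tail disjoint-at-y F×G f∈F g∈G with F×G f∈F g∈G
  ... | here (fy , gy) = contradiction gy (disjoint-at-y f∈F g∈G fy)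
  ... | there meet     = meet

  avoids : ∀ {y f F} → f ∈ avoiding y F → f y ≡ true → ⊥
  avoids {y} {F = F} f∈ fy = subst (T ∘ not) fy (proj₂ (∈-filter⁻ (T? ∘ λ f → not (f y)) {xs = F} f∈))

  cross-intersecting-#traces : ∀ Y {F G} → CrossIntersectingOn Y F G → #traces F Y + #traces G Y ≤ 2 ^ length Y
  cross-intersecting-#traces []      {[]}    {[]}    _   = z≤n
  cross-intersecting-#traces []      {[]}    {_ ∷ _} _   = ≤-refl
  cross-intersecting-#traces []      {_ ∷ _} {[]}    _   = ≤-refl
  cross-intersecting-#traces []      {_ ∷ _} {_ ∷ _} F×G with F×G (here refl) (here refl)
  ... | ()
  cross-intersecting-#traces (y ∷ Y) {F} {G} F×G = begin
    (#traces F₀ Y + #traces F₁ Y) + (#traces G₀ Y + #traces G₁ Y)   ≡⟨ lemma (#traces F₀ Y) (#traces F₁ Y) _ _ ⟩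
    (#traces F₀ Y + #traces G₁ Y) + (#traces G₀ Y + #traces F₁ Y)   ≤⟨ +-mono-≤ (cross-intersecting-#traces Y F₀×G₁)
                                                                              (cross-intersecting-#traces Y G₀×F₁) ⟩
    2 ^ length Y + 2 ^ length Y                                     ≡⟨ cong (2 ^ length Y +_) (+-identityʳ _) ⟨
    2 ^ length (y ∷ Y)                                              ∎
    where
    open ≤-Reasoning
    F₀ = avoiding y F
    F₁ = containing y F
    G₀ = avoiding y G
    G₁ = containing y G
    F₀×G₁ : CrossIntersectingOn Y F₀ G₁
    F₀×G₁ = cross-intersecting-tail (λ f∈ _ fy _ → avoids {y} {F = F} f∈ fy)
              (λ f∈ g∈ → F×G (filter-⊆ (T? ∘ _) F f∈) (filter-⊆ (T? ∘ _) G g∈))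
    G₀×F₁ : CrossIntersectingOn Y G₀ F₁
    G₀×F₁ = cross-intersecting-tail (λ g∈ _ gy _ → avoids {y} {F = G} g∈ gy)
              (λ g∈ f∈ → Any.map swap (F×G (filter-⊆ (T? ∘ _) F f∈) (filter-⊆ (T? ∘ _) G g∈)))
    lemma : ∀ a b c d → (a + b) + (c + d) ≡ (a + d) + (c + b)
    lemma = solve-∀

  DistinctOn : List X → (X → Bool) → (X → Bool) → Set
  DistinctOn Y f g = Any (λ y → f y ≢ g y) Y

  distinct-filter : ∀ {y Y F} (p : (X → Bool) → Bool) → (∀ {f g} → T (p f) → T (p g) → f y ≡ g y) →
    AllPairs (DistinctOn (y ∷ Y)) F → AllPairs (DistinctOn Y) (filterᵇ p F)
  distinct-filter {y} {Y} {F} p agree distinct =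
    AllPairs-weaken tail-distinct (all-filter (T? ∘ p) F) (AllPairs.filter⁺ (T? ∘ p) distinct)
    where
    tail-distinct : ∀ {f g} → T (p f) → T (p g) → DistinctOn (y ∷ Y) f g → DistinctOn Y f g
    tail-distinct pf pg (here fy≢gy) = contradiction (agree pf pg) fy≢gy
    tail-distinct _  _  (there d)    = d

  shearer : ∀ {k} .{{_ : NonZero k}} xs F (𝒜 : List (X → Bool)) →
    AllPairs (DistinctOn xs) F → (∀ {x} → x ∈ xs → count (λ A → A x) 𝒜 ≡ k) →
    length F ^ k ≤ product (map (λ A → #traces F (filterᵇ A xs)) 𝒜)
  shearer {suc _} [] []          𝒜 _                 _ = z≤n
  shearer {k}     [] (_ ∷ [])    𝒜 _                 _ = ≤-reflexive (trans (^-zeroˡ k) (sym (product-map-one 𝒜)))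
  shearer         [] (_ ∷ _ ∷ _) 𝒜 ((() ∷ _) ∷ _)    _
  shearer {k} (x ∷ xs) F 𝒜 distinct cover =
    subst (λ m → m ^ k ≤ product (map c 𝒜)) (sym (length≡count-not+count (λ f → f x) F))
      (geometric-mean-superadditive-flagged (λ A → A x) a b c 𝒜 (cover (here refl)) split dominated
        (shearer xs F₀ 𝒜 (distinct-filter _ (λ p q → not-injective (T-agree p q)) distinct) (cover ∘ there))
        (shearer xs F₁ 𝒜 (distinct-filter _ T-agree distinct) (cover ∘ there)))
    where
    F₀ = avoiding x F
    F₁ = containing x F
    a b c : (X → Bool) → ℕ
    a A = #traces F₀ (filterᵇ A xs)
    b A = #traces F₁ (filterᵇ A xs)
    c A = #traces F (filterᵇ A (x ∷ xs))
    split : ∀ {A} → T (A x) → c A ≡ a A + b A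
    split {A} Ax with A x | Ax
    ... | true | _ = refl
    dominated : ∀ {A} → T (not (A x)) → a A ≤ c A × b A ≤ c A
    dominated {A} ¬Ax with A x | ¬Ax
    ... | false | _ = #traces-mono (filterᵇ A xs) (filter-⊆ (T? ∘ λ f → not (f x)) F)
                    , #traces-mono (filterᵇ A xs) (filter-⊆ (T? ∘ λ f → f x) F)

  intersecting-shearer : ∀ {s k} .{{_ : NonZero k}} xs F (𝒜 : List (X → Bool)) →
    AllPairs (DistinctOn xs) F → (∀ {x} → x ∈ xs → count (λ A → A x) 𝒜 ≡ k) → length 𝒜 ≡ s * k →
    (∀ {A} → A ∈ 𝒜 → CrossIntersectingOn (filterᵇ A xs) F F) →
    2 ^ s * length F ≤ 2 ^ length xs
  intersecting-shearer {s} {k} xs F 𝒜 distinct cover length-𝒜 intersecting = ^-cancelʳ-≤ k (begin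
    (2 ^ s * length F) ^ k                                   ≡⟨ ^-distribʳ-* (2 ^ s) (length F) k ⟩
    (2 ^ s) ^ k * length F ^ k                               ≡⟨ cong (_* length F ^ k) (^-*-assoc 2 s k) ⟩
    2 ^ (s * k) * length F ^ k                               ≡⟨ cong (λ e → 2 ^ e * length F ^ k) length-𝒜 ⟨
    2 ^ length 𝒜 * length F ^ k                              ≤⟨ *-monoʳ-≤ (2 ^ length 𝒜) (shearer xs F 𝒜 distinct cover) ⟩
    2 ^ length 𝒜 * product (map (λ A → #traces F (filterᵇ A xs)) 𝒜)
                                                             ≤⟨ ^length*product≤^sum (All.tabulate two-traces) ⟩
    2 ^ sum (map (λ A → count A xs) 𝒜)                       ≡⟨ cong (2 ^_) (sum-map-count-swap (λ A x → A x) 𝒜 xs) ⟩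
    2 ^ sum (map (λ x → count (λ A → A x) 𝒜) xs)             ≡⟨ cong (2 ^_) (sum-map-const xs (All.tabulate cover)) ⟩
    2 ^ (k * length xs)                                      ≡⟨ cong (2 ^_) (*-comm k (length xs)) ⟩
    2 ^ (length xs * k)                                      ≡⟨ ^-*-assoc 2 (length xs) k ⟨
    (2 ^ length xs) ^ k                                      ∎)
    where
    open ≤-Reasoning
    two-traces : ∀ {A} → A ∈ 𝒜 → 2 * #traces F (filterᵇ A xs) ≤ 2 ^ count A xs
    two-traces {A} A∈𝒜 = subst (_≤ 2 ^ count A xs) (cong (#traces F (filterᵇ A xs) +_) (sym (+-identityʳ _)))
                           (cross-intersecting-#traces (filterᵇ A xs) (intersecting A∈𝒜))

-- Graphs on Fin n

-- The edges of the complete graph on Fin n, each listed once as (u , v) with u < v.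
pairsFromZero : ∀ n → List (Fin (suc n) × Fin (suc n))
pairsFromZero n = tabulate (λ v → zero , suc v)

increasingPairs : ∀ n → List (Fin n × Fin n)
increasingPairs zero    = []
increasingPairs (suc n) = pairsFromZero n ++ map (Product.map suc suc) (increasingPairs n)

length-increasingPairs : ∀ n → length (increasingPairs n) ≡ n C 2
length-increasingPairs zero    = refl
length-increasingPairs (suc n) = begin
  length (pairsFromZero n ++ map (Product.map suc suc) (increasingPairs n))
    ≡⟨ length-++ (pairsFromZero n) ⟩
  length (pairsFromZero n) + length (map (Product.map suc suc) (increasingPairs n))
    ≡⟨ cong₂ _+_ (length-tabulate _) (trans (length-map _ (increasingPairs n)) (length-increasingPairs n)) ⟩
  n + n C 2                ≡⟨ cong (_+ n C 2) (nC1≡n n) ⟨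
  n C 1 + n C 2            ≡⟨ nCk+nC[k+1]≡[n+1]C[k+1] n 1 ⟩
  suc n C 2                ∎
  where open ≡-Reasoning

∈-increasingPairs⁺ : ∀ {n} {u v : Fin n} → u Fin.< v → (u , v) ∈ increasingPairs n
∈-increasingPairs⁺ {suc n} {zero}  {suc v} z<s       = ∈-++⁺ˡ (∈-tabulate⁺ v)
∈-increasingPairs⁺ {suc n} {suc u} {suc v} (s<s u<v) =
  ∈-++⁺ʳ (pairsFromZero n) (∈-map⁺ (Product.map suc suc) (∈-increasingPairs⁺ u<v))

∈-increasingPairs⁻ : ∀ {n} {u v : Fin n} → (u , v) ∈ increasingPairs n → u Fin.< v
∈-increasingPairs⁻ {suc n} uv∈ with ∈-++⁻ (pairsFromZero n) uv∈
... | inj₁ uv∈tab with _ , refl ← ∈-tabulate⁻ uv∈tab = z<s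
... | inj₂ uv∈map with _ , u′v′∈ , refl ← ∈-map⁻ (Product.map suc suc) uv∈map = s<s (∈-increasingPairs⁻ u′v′∈)

colourings : ∀ s n → List (Fin n → Fin s)
colourings s zero    = (λ ()) ∷ []
colourings s (suc n) = cartesianProductWith Vector._∷_ (allFin s) (colourings s n)

length-colourings : ∀ s n → length (colourings s n) ≡ s ^ n
length-colourings s zero    = refl
length-colourings s (suc n) =
  trans (length-cartesianProductWith Vector._∷_ (allFin s) (colourings s n))
        (cong₂ _*_ (length-tabulate {n = s} id) (length-colourings s n))

monochromatic : ∀ {s n} → (Fin n → Fin s) → Fin n × Fin n → Bool
monochromatic c e = does (c (proj₁ e) Fin.≟ c (proj₂ e))

count-≟-allFin : ∀ {s} (b : Fin s) → count (λ a → does (a Fin.≟ b)) (allFin s) ≡ 1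
count-≟-allFin {suc s} zero    =
  cong suc (trans (cong (count (λ a → does (a Fin.≟ zero))) (sym (map-tabulate {n = s} id suc)))
                  (trans (count-map (λ a → does (a Fin.≟ zero)) suc (allFin s)) (count-const-false (allFin s))))
count-≟-allFin {suc s} (suc b) =
  trans (cong (count (λ a → does (a Fin.≟ suc b))) (sym (map-tabulate {n = s} id suc)))
        (trans (count-map (λ a → does (a Fin.≟ suc b)) suc (allFin s)) (count-≟-allFin b))

count-monochromatic : ∀ {s n} {u v : Fin (suc n)} → u Fin.< v →
  count (λ c → monochromatic c (u , v)) (colourings s (suc n)) ≡ s ^ n
count-monochromatic {s} {n} {zero} {suc v} z<s = begin
  count (λ c → monochromatic c (zero , suc v)) (colourings s (suc n))
    ≡⟨ count-cartesianProductWith Vector._∷_ _ (allFin s) (colourings s n) ⟩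
  sum (map (λ a → count (λ c → does (a Fin.≟ c v)) (colourings s n)) (allFin s))
    ≡⟨ sum-map-count-swap (λ a c → does (a Fin.≟ c v)) (allFin s) (colourings s n) ⟩
  sum (map (λ c → count (λ a → does (a Fin.≟ c v)) (allFin s)) (colourings s n))
    ≡⟨ sum-map-const (colourings s n) (All.tabulate λ {c} _ → count-≟-allFin (c v)) ⟩
  1 * length (colourings s n)
    ≡⟨ trans (*-identityˡ _) (length-colourings s n) ⟩
  s ^ n ∎
  where open ≡-Reasoning
count-monochromatic {s} {suc n} {suc u} {suc v} (s<s u<v) = begin
  count (λ c → monochromatic c (suc u , suc v)) (colourings s (suc (suc n)))
    ≡⟨ count-cartesianProductWith Vector._∷_ _ (allFin s) (colourings s (suc n)) ⟩
  sum (map (λ _ → count (λ c → monochromatic c (u , v)) (colourings s (suc n))) (allFin s))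
    ≡⟨ sum-map-const (allFin s) (All.tabulate λ _ → count-monochromatic u<v) ⟩
  s ^ n * length (allFin s)
    ≡⟨ trans (cong (s ^ n *_) (length-tabulate {n = s} id)) (*-comm (s ^ n) s) ⟩
  s ^ suc n ∎
  where open ≡-Reasoning

monochromatic-≡ : ∀ {s n} {c : Fin n → Fin s} {u v} → c u ≡ c v → T (monochromatic c (u , v))
monochromatic-≡ {c = c} {u} {v} same with c u Fin.≟ c v
... | yes _   = _
... | no diff = diff same

edgeSet : ∀ {n} → Graph n → Fin n × Fin n → Bool
edgeSet G e = adj G (proj₁ e) (proj₂ e)

edgeSets : ∀ {m n} → (Fin m → Graph n) → List (Fin n × Fin n → Bool)
edgeSets 𝒢 = tabulate (edgeSet ∘ 𝒢)

distinct-edgeSet : ∀ {n} {G₁ G₂ : Graph n} → Distinct G₁ G₂ →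
  DistinctOn (increasingPairs n) (edgeSet G₁) (edgeSet G₂)
distinct-edgeSet {G₁ = G₁} {G₂} (u , v , differ) with Fin.<-cmp u v
... | tri< u<v _ _  = lose (∈-increasingPairs⁺ u<v) differ
... | tri≈ _ refl _ = contradiction (trans (irrefl G₁ u) (sym (irrefl G₂ u))) differ
... | tri> _ _ v<u  = lose (∈-increasingPairs⁺ v<u)
                        λ same → differ (trans (Graph.sym G₁ u v) (trans same (Graph.sym G₂ v u)))

-- Otherwise c ∘ f would properly colour H with s colours.
monochromatic-edge : ∀ {k n s} {G : Graph n} {H : Graph k} → ContainsCopy G H → ¬ Colorable H s →
  ∀ c → Any (λ e → edgeSet G e ≡ true) (filterᵇ (monochromatic {s} c) (increasingPairs n))
monochromatic-edge {n = n} {G = G} {H} (f , _ , edge) ¬colourable c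
  with any? (λ e → edgeSet G e Bool.≟ true) (filterᵇ (monochromatic c) (increasingPairs n))
... | yes found = found
... | no  none  = contradiction (c ∘ f , proper) ¬colourable
  where
  no-monochromatic-edge : ∀ {u v} → u Fin.< v → c u ≡ c v → adj G u v ≡ true → ⊥
  no-monochromatic-edge u<v same uv =
    none (lose (∈-filter⁺ (T? ∘ monochromatic c) (∈-increasingPairs⁺ u<v) (monochromatic-≡ {c = c} same)) uv)
  proper : ∀ a b → adj H a b ≡ true → c (f a) ≢ c (f b)
  proper a b ab same with Fin.<-cmp (f a) (f b)
  ... | tri< fa<fb _ _ = no-monochromatic-edge fa<fb same (edge a b ab)
  ... | tri≈ _ fa≡fb _ =
    contradiction (trans (sym (irrefl G (f a))) (subst (λ w → adj G (f a) w ≡ true) (sym fa≡fb) (edge a b ab))) λ ()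
  ... | tri> _ _ fb<fa = no-monochromatic-edge fb<fa (sym same) (trans (Graph.sym G (f b) (f a)) (edge a b ab))

another : ∀ {m} → 2 ≤ m → (i : Fin m) → ∃ λ j → i ≢ j
another (s≤s (s≤s _)) zero    = suc zero , λ ()
another (s≤s (s≤s _)) (suc i) = zero , λ ()

common-monochromatic-edge : ∀ {k n m s} {H : Graph k} {𝒢 : Fin m → Graph n} → HIntersecting H 𝒢 →
  ¬ Colorable H s → ∀ c {i j} → i ≢ j →
  Any (λ e → edgeSet (𝒢 i) e ≡ true × edgeSet (𝒢 j) e ≡ true) (filterᵇ (monochromatic {s} c) (increasingPairs n))
common-monochromatic-edge {H = H} {𝒢} intersecting ¬colourable c {i} {j} i≢j =
  Any.map (λ {e} → ∧-≡-true {edgeSet (𝒢 i) e} {edgeSet (𝒢 j) e})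
    (monochromatic-edge {G = 𝒢 i ∩ 𝒢 j} {H} (intersecting i j i≢j) ¬colourable c)

intersecting-edgeSets : ∀ {k n m s} {H : Graph k} {𝒢 : Fin m → Graph n} → 2 ≤ m → HIntersecting H 𝒢 →
  ¬ Colorable H s → ∀ c → CrossIntersectingOn (filterᵇ (monochromatic {s} c) (increasingPairs n)) (edgeSets 𝒢) (edgeSets 𝒢)
intersecting-edgeSets {H = H} {𝒢} 2≤m intersecting ¬colourable c f∈ g∈
  with i , refl ← ∈-tabulate⁻ {f = edgeSet ∘ 𝒢} f∈ | j , refl ← ∈-tabulate⁻ {f = edgeSet ∘ 𝒢} g∈
  with i Fin.≟ j
... | no  i≢j  = common-monochromatic-edge {H = H} {𝒢} intersecting ¬colourable c i≢j
... | yes refl with j′ , i≢j′ ← another 2≤m i =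
  Any.map (λ both → proj₁ both , proj₁ both) (common-monochromatic-edge {H = H} {𝒢} intersecting ¬colourable c i≢j′)

intersecting-graphs-bound : ∀ {k n m s} .{{_ : NonZero s}} (H : Graph k) (𝒢 : Fin m → Graph (suc n)) → 2 ≤ m →
  PairwiseDistinct 𝒢 → HIntersecting H 𝒢 → ¬ Colorable H s → 2 ^ s * m ≤ 2 ^ (suc n C 2)
intersecting-graphs-bound {n = n} {m} {s} H 𝒢 2≤m distinct intersecting ¬colourable =
  subst₂ (λ a b → 2 ^ s * a ≤ 2 ^ b) (length-tabulate {n = m} (edgeSet ∘ 𝒢)) (length-increasingPairs (suc n))
    (intersecting-shearer {s = s} {{m^n≢0 s n}} (increasingPairs (suc n)) (edgeSets 𝒢) 𝒜
      (AllPairs.tabulate⁺ λ {i} {j} i≢j → distinct-edgeSet {G₁ = 𝒢 i} {𝒢 j} (distinct i j i≢j))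
      cover
      (trans (length-map monochromatic (colourings s (suc n))) (length-colourings s (suc n)))
      intersecting-on)
  where
  𝒜 = map monochromatic (colourings s (suc n))
  cover : ∀ {e} → e ∈ increasingPairs (suc n) → count (λ A → A e) 𝒜 ≡ s ^ n
  cover {e} e∈ = trans (count-map (λ A → A e) monochromatic (colourings s (suc n)))
                       (count-monochromatic (∈-increasingPairs⁻ e∈))
  intersecting-on : ∀ {A} → A ∈ 𝒜 → CrossIntersectingOn (filterᵇ A (increasingPairs (suc n))) (edgeSets 𝒢) (edgeSets 𝒢)
  intersecting-on A∈ with c , _ , refl ← ∈-map⁻ monochromatic A∈ =
    intersecting-edgeSets {H = H} {𝒢} 2≤m intersecting ¬colourable c

chromatic-number-bounds : ∀ {k χ} {H : Graph k} → NonEmpty H → IsChromaticNumber H χ →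
  NonZero (χ ∸ 1) × ¬ Colorable H (χ ∸ 1)
chromatic-number-bounds {χ = zero}        (u , _)      ((colour , _) , _)      with () ← colour u
chromatic-number-bounds {χ = suc zero}    (u , v , uv) ((colour , proper) , _) =
  contradiction (one-colour (colour u) (colour v)) (proper u v uv)
  where
  one-colour : ∀ (a b : Fin 1) → a ≡ b
  one-colour zero zero = refl
chromatic-number-bounds {χ = suc (suc s)} _ (_ , minimal) = _ , λ colourable → <-irrefl refl (minimal (suc s) colourable)

proposition7 : ∀ {k} (H : Graph k) → NonEmpty H → (n m : ℕ) (𝒢 : Fin m → Graph n)
    → PairwiseDistinct 𝒢 → HIntersecting H 𝒢
    → (χ : ℕ) → IsChromaticNumber H χ
    → m ≤ 2 ^ ((n C 2) ∸ (χ ∸ 1))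
proposition7 H _        n       zero          𝒢 _ _ _ _ = z≤n
proposition7 H _        n       (suc zero)    𝒢 _ _ χ _ = m^n>0 2 (n C 2 ∸ (χ ∸ 1))
proposition7 H (u , _)  zero    (suc (suc _)) 𝒢 _ intersecting _ _
  with () ← proj₁ (intersecting zero (suc zero) λ ()) u
proposition7 H nonEmpty (suc n) m@(suc (suc _)) 𝒢 distinct intersecting χ chromatic
  with s≢0 , ¬colourable ← chromatic-number-bounds {χ = χ} {H} nonEmpty chromatic =
  m≤^∸ (χ ∸ 1) (s<s z<s)
    (intersecting-graphs-bound {n = n} {m} {χ ∸ 1} {{s≢0}} H 𝒢 (s≤s (s≤s z≤n)) distinct intersecting ¬colourable)
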